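{- Let $\Omega_\rho$ be a finite list of atomic rules (elements of $\{\rho^+,\rho^-\}$) and $\mu\in\{\pi^+,\pi^-,\mathfrak{4},\lambda,\mathsf{J}\}$. For all modal trees $\mathtt{T},\mathtt{S}$: if $\mathtt{T}\hookrightarrow^{\Omega_\rho}\circ\hookrightarrow^{\mu}\mathtt{S}$, then $\mathtt{T}\hookrightarrow^{\mu}\circ\hookrightarrow^{\Omega'_\rho}\mathtt{S}$ for some finite list $\Omega'_\rho$ of atomic rules.
   Context: Modal trees: recursively, pairs $\langle\Delta;\Gamma\rangle$ with $\Delta$ a finite list of propositional variables and $\Gamma$ a finite list of pairs $(\alpha,\mathtt{S})$, $\alpha<\omega$, $\mathtt{S}$ a modal tree. Positions: $\mathrm{Pos}(\langle\Delta;\varnothing\rangle)=\{\epsilon\}$; $\mathrm{Pos}(\langle\Delta;[(\alpha_1,\mathtt{S}_1),\dots,(\alpha_n,\mathtt{S}_n)]\rangle)=\{\epsilon\}\cup\bigcup_{i=1}^n\{i\mathbf{k}\mid\mathbf{k}\in\mathrm{Pos}(\mathtt{S}_i)\}$. Subtree: $\mathtt{T}|_\epsilon=\mathtt{T}$, $\mathtt{T}|_{i\mathbf{r}}=\mathtt{S}_i|_{\mathbf{r}}$. Replacement: $\mathtt{T}[\mathtt{S}]_\epsilon=\mathtt{S}$, $\mathtt{T}[\mathtt{S}]_{i\mathbf{r}}$ is $\mathtt{T}$ with its $i$-th child $\mathtt{S}_i$ replaced by $\mathtt{S}_i[\mathtt{S}]_{\mathbf{r}}$ (same edge label). List operations,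 for $0<i,j\le|\Gamma|$: $\#_i\Gamma$ is the $i$-th element; $\Gamma^{ -i}$ deletes it; $\Gamma^{+i}=(\#_i\Gamma)\frown\Gamma$; $\Gamma[x]_i$ replaces the $i$-th element by $x$; similarly $\Delta^{ -n}$ deletes the $n$-th element of $\Delta$ and $\Delta^{+n}=(n\text{ -th element of }\Delta)\frown\Delta$. Rules: for a modal tree $\mathtt{T}$, $\mathbf{k}\in\mathrm{Pos}(\mathtt{T})$ with $\mathtt{T}|_\mathbf{k}=\langle\Delta;\Gamma\rangle$: ($\rho^+$) $\mathtt{T}\hookrightarrow^{\rho^+}\mathtt{T}[\langle\Delta^{+i};\Gamma\rangle]_\mathbf{k}$, $0<i\le|\Delta|$; ($\rho^-$) $\mathtt{T}\hookrightarrow^{\rho^- }\mathtt{T}[\langle\Delta^{ -i};\Gamma\rangle]_\mathbf{k}$; ($\pi^+$) $\mathtt{T}\hookrightarrow^{\pi^+}\mathtt{T}[\langle\Delta;\Gamma^{+i}\rangle]_\mathbf{k}$; ($\pi^-$) $\mathtt{T}\hookrightarrow^{\pi^- }\mathtt{T}[\langle\Delta;\Gamma^{ -i}\rangle]_\mathbf{k}$; ($\mathfrak{4}$) if $\#_i\Gamma=(\beta,\langle\tilde\Delta;\tilde\Gamma\rangle)$ and $\#_j\tilde\Gamma=(\beta,\mathtt{S})$, then $\mathtt{T}\hookrightarrow^{\mathfrak{4}}\mathtt{T}[\langle\Delta;\Gamma[(\beta,\mathtt{S})]_i\rangle]_\mathbf{k}$; ($\lambda$) if $\#_i\Gamma=(\alpha,\mathtt{S})$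 and $\alpha>\beta$, then $\mathtt{T}\hookrightarrow^{\lambda}\mathtt{T}[\langle\Delta;\Gamma[(\beta,\mathtt{S})]_i\rangle]_\mathbf{k}$; ($\mathsf{J}$) if $i\ne j$, $\#_i\Gamma=(\alpha,\langle\tilde\Delta;\tilde\Gamma\rangle)$, $\#_j\Gamma=(\beta,\mathtt{S})$, $\alpha>\beta$, then $\mathtt{T}\hookrightarrow^{\mathsf{J}}\mathtt{T}[\langle\Delta;(\Gamma[(\alpha,\langle\tilde\Delta;\tilde\Gamma\frown(\beta,\mathtt{S})\rangle)]_i)^{ -j}\rangle]_\mathbf{k}$. Notation: for a list $\Omega$ of rules, $\mathtt{T}\hookrightarrow^{\Omega}\mathtt{S}$ means $\mathtt{S}=\mathtt{T}$ if $\Omega=\varnothing$, and $\mathtt{T}\hookrightarrow^{\mu}\mathtt{U}\hookrightarrow^{\hat\Omega}\mathtt{S}$ for some $\mathtt{U}$ if $\Omega=\mu\frown\hat\Omega$; $\mathtt{T}\hookrightarrow^{X}\circ\hookrightarrow^{Y}\mathtt{S}$ means there is $\mathtt{U}$ with $\mathtt{T}\hookrightarrow^{X}\mathtt{U}\hookrightarrow^{Y}\mathtt{S}$. -}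

module Defs where

open import Data.Nat using (ℕ; zero; suc; _<_)
open import Data.List using (List; []; _∷_; _++_; [_])
open import Data.List.Relation.Unary.All using (All)
open import Data.Product using (_×_; _,_; Σ; ∃; ∃-syntax)
open import Data.Maybe using (Maybe; just; nothing)
open import Relation.Binary.PropositionalEquality using (_≡_; _≢_)

-- Propositional variables are represented by natural numbers;
-- edge labels α < ω are natural numbers.
Var : Set
Var = ℕ

data Tree : Set where
  node : List Var → List (ℕ × Tree) → Tree

-- 1-based list operations (index 0 and out-of-range indices are invalid)

nth : {A : Set} → List A → ℕ → Maybe A
nth []       _             = nothing
nth (x ∷ xs) zero          = nothing
nth (x ∷ xs) (suc zero)    = just x
nth (x ∷ xs) (suc (suc n)) = nth xs (suc n)

del : {A : Set} → ℕ → List A → List A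
del _             []       = []
del zero          (x ∷ xs) = x ∷ xs
del (suc zero)    (x ∷ xs) = xs
del (suc (suc n)) (x ∷ xs) = x ∷ del (suc n) xs

upd : {A : Set} → ℕ → A → List A → List A
upd _             y []       = []
upd zero          y (x ∷ xs) = x ∷ xs
upd (suc zero)    y (x ∷ xs) = y ∷ xs
upd (suc (suc n)) y (x ∷ xs) = x ∷ upd (suc n) y xs

-- Positions (as lists of 1-based child indices), subtrees, replacement.
-- k ∈ Pos(T) iff subtree T k ≡ just _.

Position : Set
Position = List ℕ

mutual
  subtree : Tree → Position → Maybe Tree
  subtree T []                = just T
  subtree (node Δ Γ) (i ∷ r)  = subtreeL Γ i r

  subtreeL : List (ℕ × Tree) → ℕ → Position → Maybe Tree
  subtreeL []             _             r = nothing
  subtreeL ((α , S) ∷ Γ)  zero          r = nothing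
  subtreeL ((α , S) ∷ Γ)  (suc zero)    r = subtree S r
  subtreeL ((α , S) ∷ Γ)  (suc (suc n)) r = subtreeL Γ (suc n) r

-- replace T S k  is  T[S]_k  (only meaningful for k ∈ Pos(T))
mutual
  replace : Tree → Tree → Position → Tree
  replace T S []               = S
  replace (node Δ Γ) S (i ∷ r) = node Δ (replaceL Γ S i r)

  replaceL : List (ℕ × Tree) → Tree → ℕ → Position → List (ℕ × Tree)
  replaceL []            S _             r = []
  replaceL ((α , U) ∷ Γ) S zero          r = (α , U) ∷ Γ
  replaceL ((α , U) ∷ Γ) S (suc zero)    r = (α , replace U S r) ∷ Γ
  replaceL ((α , U) ∷ Γ) S (suc (suc n)) r = (α , U) ∷ replaceL Γ S (suc n) r

data Rule : Set where
  ρ⁺ ρ⁻ π⁺ π⁻ 𝔣𝔬𝔲𝔯 λᵣ J : Rule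

data IsRho : Rule → Set where
  isρ⁺ : IsRho ρ⁺
  isρ⁻ : IsRho ρ⁻

data IsNonRho : Rule → Set where
  isπ⁺ : IsNonRho π⁺
  isπ⁻ : IsNonRho π⁻
  is𝔣𝔬𝔲𝔯 : IsNonRho 𝔣𝔬𝔲𝔯
  isλ  : IsNonRho λᵣ
  isJ  : IsNonRho J

data RootStep : Rule → Tree → Tree → Set where
  rρ⁺ : ∀ {Δ Γ i p} → nth Δ i ≡ just p →
        RootStep ρ⁺ (node Δ Γ) (node (p ∷ Δ) Γ)
  rρ⁻ : ∀ {Δ Γ i p} → nth Δ i ≡ just p →
        RootStep ρ⁻ (node Δ Γ) (node (del i Δ) Γ)
  rπ⁺ : ∀ {Δ Γ i x} → nth Γ i ≡ just x →
        RootStep π⁺ (node Δ Γ) (node Δ (x ∷ Γ))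
  rπ⁻ : ∀ {Δ Γ i x} → nth Γ i ≡ just x →
        RootStep π⁻ (node Δ Γ) (node Δ (del i Γ))
  r𝔣𝔬𝔲𝔯 : ∀ {Δ Γ i j β Δ' Γ' S} →
        nth Γ i ≡ just (β , node Δ' Γ') → nth Γ' j ≡ just (β , S) →
        RootStep 𝔣𝔬𝔲𝔯 (node Δ Γ) (node Δ (upd i (β , S) Γ))
  rλ  : ∀ {Δ Γ i α β S} → nth Γ i ≡ just (α , S) → β < α →
        RootStep λᵣ (node Δ Γ) (node Δ (upd i (β , S) Γ))
  rJ  : ∀ {Δ Γ i j α β Δ' Γ' S} → i ≢ j →
        nth Γ i ≡ just (α , node Δ' Γ') → nth Γ j ≡ just (β , S) → β < α →
        RootStep J (node Δ Γ)
          (node Δ (del j (upd i (α , node Δ' (Γ' ++ [ (β , S) ])) Γ)))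

Step : Rule → Tree → Tree → Set
Step μ T S = ∃[ k ] ∃[ U ] ∃[ R ]
  (subtree T k ≡ just U × RootStep μ U R × S ≡ replace T R k)

Steps : List Rule → Tree → Tree → Set
Steps []      T S = T ≡ S
Steps (μ ∷ Ω) T S = ∃[ U ] (Step μ T U × Steps Ω U S)

{-# OPTIONS --safe #-}
-- The rules ρ⁺ and ρ⁻ only duplicate or delete propositional variables, so T ↪^Ωρ U
-- holds exactly when T ⊒ U: both trees have the same shape and edge labels, and at
-- every node the variables of U occur among those of T. The rules π⁺, π⁻, 4, λ, J
-- never inspect variables, so a μ-step out of U is simulated by a μ-step out of any
-- T ⊒ U at the same position, and the results are again related by ⊒.
module Submission where

open import Defs
open import Data.Nat using (ℕ; zero; suc)
open import Data.List using (List; []; _∷_; _++_; [_]; length)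
open import Data.List.Properties using (++-assoc; ++-identityʳ)
open import Data.List.Relation.Unary.All using (All; []; _∷_)
open import Data.List.Relation.Unary.All.Properties using (++⁺)
open import Data.List.Relation.Unary.Any using (here; there)
open import Data.List.Membership.Propositional using (_∈_)
open import Data.List.Relation.Binary.Subset.Propositional using (_⊆_)
open import Data.List.Relation.Binary.Subset.Propositional.Properties
  using (⊆-refl; ⊆-trans; ∈-∷⁺ʳ; xs⊆ys++xs)
open import Data.Product using (_×_; _,_; ∃-syntax)
open import Data.Maybe using (just)
open import Relation.Binary.PropositionalEquality
  using (_≡_; refl; sym; trans; cong; subst; subst₂)

private
  variable
    A : Set
    x : A
    xs : List A
    μ : Rule
    Ω : List Rule
    T U V R S : Tree
    Γ Γ₁ Γ₂ Γ₃ : List (ℕ × Tree)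

nth⇒∈ : ∀ (xs : List A) i → nth xs i ≡ just x → x ∈ xs
nth⇒∈ (y ∷ xs) (suc zero)    refl = here refl
nth⇒∈ (y ∷ xs) (suc (suc i)) e    = there (nth⇒∈ xs (suc i) e)

∈⇒nth : x ∈ xs → ∃[ i ] (nth xs (suc i) ≡ just x)
∈⇒nth (here refl) = zero , refl
∈⇒nth (there p) with ∈⇒nth p
... | i , e = suc i , e

del⊆ : ∀ i (xs : List A) → del i xs ⊆ xs
del⊆ i             []       p         = p
del⊆ zero          (y ∷ xs) p         = p
del⊆ (suc zero)    (y ∷ xs) p         = there p
del⊆ (suc (suc i)) (y ∷ xs) (here e)  = here e
del⊆ (suc (suc i)) (y ∷ xs) (there p) = there (del⊆ (suc i) xs p)

nth-++-∷ : ∀ (xs : List A) y ys → nth (xs ++ y ∷ ys) (suc (length xs)) ≡ just y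
nth-++-∷ []       y ys = refl
nth-++-∷ (x ∷ xs) y ys = nth-++-∷ xs y ys

del-++-∷ : ∀ (xs : List A) y ys → del (suc (length xs)) (xs ++ y ∷ ys) ≡ xs ++ ys
del-++-∷ []       y ys = refl
del-++-∷ (x ∷ xs) y ys = cong (x ∷_) (del-++-∷ xs y ys)

subtreeL-++-∷ : ∀ Γ a S Γ′ r → subtreeL (Γ ++ (a , S) ∷ Γ′) (suc (length Γ)) r ≡ subtree S r
subtreeL-++-∷ []      a S Γ′ r = refl
subtreeL-++-∷ (_ ∷ Γ) a S Γ′ r = subtreeL-++-∷ Γ a S Γ′ r

replaceL-++-∷ : ∀ Γ a S Γ′ R r →
  replaceL (Γ ++ (a , S) ∷ Γ′) R (suc (length Γ)) r ≡ Γ ++ (a , replace S R r) ∷ Γ′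
replaceL-++-∷ []      a S Γ′ R r = refl
replaceL-++-∷ (y ∷ Γ) a S Γ′ R r = cong (y ∷_) (replaceL-++-∷ Γ a S Γ′ R r)

infix 4 _⊒_ _⊒ˡ_

mutual
  data _⊒_ : Tree → Tree → Set where
    node : ∀ {Δ Δ′ Γ Γ′} → Δ′ ⊆ Δ → Γ ⊒ˡ Γ′ → node Δ Γ ⊒ node Δ′ Γ′

  data _⊒ˡ_ : List (ℕ × Tree) → List (ℕ × Tree) → Set where
    []  : [] ⊒ˡ []
    _∷_ : ∀ {a S S′ Γ Γ′} → S ⊒ S′ → Γ ⊒ˡ Γ′ → (a , S) ∷ Γ ⊒ˡ (a , S′) ∷ Γ′

mutual
  ⊒-refl : ∀ T → T ⊒ T
  ⊒-refl (node Δ Γ) = node ⊆-refl (⊒ˡ-refl Γ)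

  ⊒ˡ-refl : ∀ Γ → Γ ⊒ˡ Γ
  ⊒ˡ-refl []            = []
  ⊒ˡ-refl ((a , S) ∷ Γ) = ⊒-refl S ∷ ⊒ˡ-refl Γ

mutual
  ⊒-trans : T ⊒ U → U ⊒ V → T ⊒ V
  ⊒-trans (node p ps) (node q qs) = node (⊆-trans q p) (⊒ˡ-trans ps qs)

  ⊒ˡ-trans : Γ₁ ⊒ˡ Γ₂ → Γ₂ ⊒ˡ Γ₃ → Γ₁ ⊒ˡ Γ₃
  ⊒ˡ-trans []       []       = []
  ⊒ˡ-trans (p ∷ ps) (q ∷ qs) = ⊒-trans p q ∷ ⊒ˡ-trans ps qs

⊒ˡ-nth : Γ₁ ⊒ˡ Γ₂ → ∀ i {a S′} → nth Γ₂ i ≡ just (a , S′) →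
  ∃[ S ] (nth Γ₁ i ≡ just (a , S) × S ⊒ S′)
⊒ˡ-nth (p ∷ ps) (suc zero)    refl = _ , refl , p
⊒ˡ-nth (p ∷ ps) (suc (suc i)) e    = ⊒ˡ-nth ps (suc i) e

⊒ˡ-del : Γ₁ ⊒ˡ Γ₂ → ∀ i → del i Γ₁ ⊒ˡ del i Γ₂
⊒ˡ-del []       i             = []
⊒ˡ-del (p ∷ ps) zero          = p ∷ ps
⊒ˡ-del (p ∷ ps) (suc zero)    = ps
⊒ˡ-del (p ∷ ps) (suc (suc i)) = p ∷ ⊒ˡ-del ps (suc i)

⊒ˡ-upd : Γ₁ ⊒ˡ Γ₂ → ∀ i {a S S′} → S ⊒ S′ → upd i (a , S) Γ₁ ⊒ˡ upd i (a , S′) Γ₂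
⊒ˡ-upd []       i             q = []
⊒ˡ-upd (p ∷ ps) zero          q = p ∷ ps
⊒ˡ-upd (p ∷ ps) (suc zero)    q = q ∷ ps
⊒ˡ-upd (p ∷ ps) (suc (suc i)) q = p ∷ ⊒ˡ-upd ps (suc i) q

⊒ˡ-++ : ∀ {Γ₁ Γ₂ Γ₁′ Γ₂′} → Γ₁ ⊒ˡ Γ₂ → Γ₁′ ⊒ˡ Γ₂′ → Γ₁ ++ Γ₁′ ⊒ˡ Γ₂ ++ Γ₂′
⊒ˡ-++ []       qs = qs
⊒ˡ-++ (p ∷ ps) qs = p ∷ ⊒ˡ-++ ps qs

mutual
  subtree-⊒ : T ⊒ U → ∀ k {U′} → subtree U k ≡ just U′ →
    ∃[ T′ ] (subtree T k ≡ just T′ × T′ ⊒ U′)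
  subtree-⊒ p           []      refl = _ , refl , p
  subtree-⊒ (node _ ps) (i ∷ r) e    = subtreeL-⊒ ps i r e

  subtreeL-⊒ : Γ₁ ⊒ˡ Γ₂ → ∀ i r {U′} → subtreeL Γ₂ i r ≡ just U′ →
    ∃[ T′ ] (subtreeL Γ₁ i r ≡ just T′ × T′ ⊒ U′)
  subtreeL-⊒ (p ∷ ps) (suc zero)    r e = subtree-⊒ p r e
  subtreeL-⊒ (p ∷ ps) (suc (suc i)) r e = subtreeL-⊒ ps (suc i) r e

mutual
  replace-⊒ : T ⊒ U → R ⊒ S → ∀ k → replace T R k ⊒ replace U S k
  replace-⊒ p           q []      = q
  replace-⊒ (node d ps) q (i ∷ r) = node d (replaceL-⊒ ps q i r)

  replaceL-⊒ : Γ₁ ⊒ˡ Γ₂ → R ⊒ S → ∀ i r → replaceL Γ₁ R i r ⊒ˡ replaceL Γ₂ S i r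
  replaceL-⊒ []       q i             r = []
  replaceL-⊒ (p ∷ ps) q zero          r = p ∷ ps
  replaceL-⊒ (p ∷ ps) q (suc zero)    r = replace-⊒ p q r ∷ ps
  replaceL-⊒ (p ∷ ps) q (suc (suc i)) r = p ∷ replaceL-⊒ ps q (suc i) r

mutual
  ⊒-replace : ∀ T k → subtree T k ≡ just V → V ⊒ R → T ⊒ replace T R k
  ⊒-replace T          []      refl q = q
  ⊒-replace (node Δ Γ) (i ∷ r) e    q = node ⊆-refl (⊒ˡ-replaceL Γ i r e q)

  ⊒ˡ-replaceL : ∀ Γ i r → subtreeL Γ i r ≡ just V → V ⊒ R → Γ ⊒ˡ replaceL Γ R i r
  ⊒ˡ-replaceL ((a , U) ∷ Γ) (suc zero)    r e q = ⊒-replace U r e q ∷ ⊒ˡ-refl Γ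
  ⊒ˡ-replaceL ((a , U) ∷ Γ) (suc (suc i)) r e q = ⊒-refl U ∷ ⊒ˡ-replaceL Γ (suc i) r e q

simulate-RootStep : IsNonRho μ → T ⊒ U → RootStep μ U S →
  ∃[ R ] (RootStep μ T R × R ⊒ S)
simulate-RootStep isπ⁺ (node d ps) (rπ⁺ {i = i} e) with ⊒ˡ-nth ps i e
... | _ , e′ , p = _ , rπ⁺ e′ , node d (p ∷ ps)
simulate-RootStep isπ⁻ (node d ps) (rπ⁻ {i = i} e) with ⊒ˡ-nth ps i e
... | _ , e′ , _ = _ , rπ⁻ e′ , node d (⊒ˡ-del ps i)
simulate-RootStep is𝔣𝔬𝔲𝔯 (node d ps) (r𝔣𝔬𝔲𝔯 {i = i} {j = j} eᵢ eⱼ) with ⊒ˡ-nth ps i eᵢ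
... | _ , eᵢ′ , node _ qs with ⊒ˡ-nth qs j eⱼ
...   | _ , eⱼ′ , q = _ , r𝔣𝔬𝔲𝔯 eᵢ′ eⱼ′ , node d (⊒ˡ-upd ps i q)
simulate-RootStep isλ (node d ps) (rλ {i = i} e β<α) with ⊒ˡ-nth ps i e
... | _ , e′ , p = _ , rλ e′ β<α , node d (⊒ˡ-upd ps i p)
simulate-RootStep isJ (node d ps) (rJ {i = i} {j = j} i≢j eᵢ eⱼ β<α) with ⊒ˡ-nth ps i eᵢ
... | _ , eᵢ′ , node d′ qs with ⊒ˡ-nth ps j eⱼ
...   | _ , eⱼ′ , q = _ , rJ i≢j eᵢ′ eⱼ′ β<α ,
  node d (⊒ˡ-del (⊒ˡ-upd ps i (node d′ (⊒ˡ-++ qs (q ∷ [])))) j)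

simulate-Step : IsNonRho μ → T ⊒ U → Step μ U S → ∃[ R ] (Step μ T R × R ⊒ S)
simulate-Step nr p (k , U′ , S′ , e , st , refl) with subtree-⊒ p k e
... | T′ , e′ , q with simulate-RootStep nr q st
...   | R′ , st′ , r = _ , (k , T′ , R′ , e′ , st′ , refl) , replace-⊒ p r k

RootStep-ρ⇒⊒ : IsRho μ → RootStep μ T U → T ⊒ U
RootStep-ρ⇒⊒ isρ⁺ (rρ⁺ {Δ = Δ} {Γ = Γ} {i = i} e) = node (∈-∷⁺ʳ (nth⇒∈ Δ i e) ⊆-refl) (⊒ˡ-refl Γ)
RootStep-ρ⇒⊒ isρ⁻ (rρ⁻ {Δ = Δ} {Γ = Γ} {i = i} e) = node (del⊆ i Δ) (⊒ˡ-refl Γ)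

Steps-ρ⇒⊒ : All IsRho Ω → Steps Ω T U → T ⊒ U
Steps-ρ⇒⊒ {T = T} []       refl = ⊒-refl T
Steps-ρ⇒⊒ {T = T} (r ∷ rs) (_ , (k , _ , _ , e , st , refl) , sts) =
  ⊒-trans (⊒-replace T k e (RootStep-ρ⇒⊒ r st)) (Steps-ρ⇒⊒ rs sts)

infix 4 _↪ρ*_

_↪ρ*_ : Tree → Tree → Set
T ↪ρ* U = ∃[ Ω ] (All IsRho Ω × Steps Ω T U)

Steps-++ : ∀ {Ω Ω′} → Steps Ω T U → Steps Ω′ U V → Steps (Ω ++ Ω′) T V
Steps-++ {Ω = []}    refl         q = q
Steps-++ {Ω = _ ∷ _} (U , s , ss) q = U , s , Steps-++ ss q

↪ρ*-refl : T ↪ρ* T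
↪ρ*-refl = [] , [] , refl

↪ρ*-trans : T ↪ρ* U → U ↪ρ* V → T ↪ρ* V
↪ρ*-trans (Ω , rs , ss) (Ω′ , rs′ , ss′) = Ω ++ Ω′ , ++⁺ rs rs′ , Steps-++ ss ss′

RootStep⇒↪ρ* : IsRho μ → RootStep μ T U → T ↪ρ* U
RootStep⇒↪ρ* {μ = μ} r st = μ ∷ [] , r ∷ [] , _ , ([] , _ , _ , refl , st , refl) , refl

↪ρ*-≡ : T ≡ U → T ↪ρ* U
↪ρ*-≡ refl = ↪ρ*-refl

module _ (Δ : List Var) (Γ : List (ℕ × Tree)) (a : ℕ) (Γ′ : List (ℕ × Tree)) where

  private
    inChild : Tree → Tree
    inChild S = node Δ (Γ ++ (a , S) ∷ Γ′)

  Step-child : Step μ S R → Step μ (inChild S) (inChild R)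
  Step-child {S = S} (k , V , R , e , st , refl) =
    suc (length Γ) ∷ k , V , R , trans (subtreeL-++-∷ Γ a S Γ′ k) e , st ,
    cong (node Δ) (sym (replaceL-++-∷ Γ a S Γ′ R k))

  Steps-child : Steps Ω S R → Steps Ω (inChild S) (inChild R)
  Steps-child {Ω = []}    refl         = refl
  Steps-child {Ω = _ ∷ _} (U , s , ss) = _ , Step-child s , Steps-child ss

  ↪ρ*-child : S ↪ρ* R → inChild S ↪ρ* inChild R
  ↪ρ*-child (Ω , rs , ss) = Ω , rs , Steps-child ss

prepend-atoms : ∀ Δ′ {Δ Γ} → Δ′ ⊆ Δ → node Δ Γ ↪ρ* node (Δ′ ++ Δ) Γ
prepend-atoms []        _  = ↪ρ*-refl
prepend-atoms (y ∷ Δ′) {Δ} Δ′⊆Δ with ∈⇒nth (xs⊆ys++xs Δ Δ′ (Δ′⊆Δ (here refl)))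
... | _ , e = ↪ρ*-trans (prepend-atoms Δ′ (λ p → Δ′⊆Δ (there p))) (RootStep⇒↪ρ* isρ⁺ (rρ⁺ e))

drop-suffix-atoms : ∀ Δ′ Δ {Γ} → node (Δ′ ++ Δ) Γ ↪ρ* node Δ′ Γ
drop-suffix-atoms Δ′ []      = ↪ρ*-≡ (cong (λ Δ″ → node Δ″ _) (++-identityʳ Δ′))
drop-suffix-atoms Δ′ (y ∷ Δ) {Γ} =
  ↪ρ*-trans (RootStep⇒↪ρ* isρ⁻ (rρ⁻ {Γ = Γ} (nth-++-∷ Δ′ y Δ)))
    (subst (λ Δ″ → node Δ″ Γ ↪ρ* node Δ′ Γ) (sym (del-++-∷ Δ′ y Δ)) (drop-suffix-atoms Δ′ Δ))

mutual
  ⊒⇒↪ρ* : T ⊒ U → T ↪ρ* U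
  ⊒⇒↪ρ* (node {Δ} {Δ′} Δ′⊆Δ ps) =
    ↪ρ*-trans (⊒ˡ⇒↪ρ* ps Δ [])
      (↪ρ*-trans (prepend-atoms Δ′ Δ′⊆Δ) (drop-suffix-atoms Δ′ Δ))

  -- The children before Γ₁ have already been rewritten; they are accumulated in Γ.
  ⊒ˡ⇒↪ρ* : Γ₁ ⊒ˡ Γ₂ → ∀ Δ Γ → node Δ (Γ ++ Γ₁) ↪ρ* node Δ (Γ ++ Γ₂)
  ⊒ˡ⇒↪ρ* []                                Δ Γ = ↪ρ*-refl
  ⊒ˡ⇒↪ρ* (_∷_ {a} {_} {S′} {Γ₁} {Γ₂} p ps) Δ Γ =
    ↪ρ*-trans (↪ρ*-child Δ Γ a Γ₁ (⊒⇒↪ρ* p))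
      (subst₂ (λ Γ₃ Γ₄ → node Δ Γ₃ ↪ρ* node Δ Γ₄)
        (++-assoc Γ [ (a , S′) ] Γ₁) (++-assoc Γ [ (a , S′) ] Γ₂)
        (⊒ˡ⇒↪ρ* ps Δ (Γ ++ [ (a , S′) ])))

mainTheorem18 : (Ωρ : List Rule) → All IsRho Ωρ → (μ : Rule) → IsNonRho μ →
    (T S : Tree) → (∃[ U ] (Steps Ωρ T U × Step μ U S)) →
    ∃[ Ω' ] (All IsRho Ω' × ∃[ U ] (Step μ T U × Steps Ω' U S))
mainTheorem18 Ωρ ρs μ nr T S (U , T↪U , U↪S) with simulate-Step nr (Steps-ρ⇒⊒ ρs T↪U) U↪S
... | R , T↪R , R⊒S with ⊒⇒↪ρ* R⊒S
...   | Ω′ , ρs′ , R↪S = Ω′ , ρs′ , R , T↪R , R↪S
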